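{- For every integer $n \ge 1$, the reverse permutation $R_n = (n, n-1, \ldots, 2, 1)$ can be transformed into the identity permutation $I_n = (1,2,\ldots,n)$ by a sequence of at most $\frac{3}{2}n^2$ LRE moves. (For $n\ge 3$, a sequence of exactly $\frac{3}{2}n^2 - \frac{19}{2}n + 18$ moves suffices.)
   Context: Permutations of $\{1,\ldots,n\}$ are written as sequences $(a_1,\ldots,a_n)$. The LRE moves are: $L$ (left rotate), $(a_1,\ldots,a_n)\mapsto(a_2,\ldots,a_n,a_1)$; $R$ (right rotate), $(a_1,\ldots,a_n)\mapsto(a_n,a_1,\ldots,a_{n-1})$; $E$ (exchange), $(a_1,a_2,a_3,\ldots,a_n)\mapsto(a_2,a_1,a_3,\ldots,a_n)$. Moves are applied one after another. -}

module Defs where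

open import Data.Nat using (ℕ; zero; suc)
open import Data.List using (List; []; _∷_; _++_; reverse; upTo; map; foldl)

Perm : Set
Perm = List ℕ

data Move : Set where
  L R E : Move

rotL : Perm → Perm
rotL []       = []
rotL (a ∷ as) = as ++ (a ∷ [])

-- R : (a₁,…,aₙ) ↦ (aₙ,a₁,…,aₙ₋₁)
rotR : Perm → Perm
rotR xs = reverse (rotL (reverse xs))

exch : Perm → Perm
exch (a ∷ b ∷ as) = b ∷ a ∷ as
exch xs           = xs

applyMove : Move → Perm → Perm
applyMove L = rotL
applyMove R = rotR
applyMove E = exch

applyMoves : List Move → Perm → Perm
applyMoves []       p = p
applyMoves (m ∷ ms) p = applyMoves ms (applyMove m p)

identityPerm : ℕ → Perm
identityPerm n = map suc (upTo n)

reversePerm : ℕ → Perm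
reversePerm n = reverse (identityPerm n)

-- A round of 4k + 2 moves (L, then (E L)ᵏ, E, (R E)ᵏ) turns a b ds c zs, with ds of
-- length k, into c ds b zs a: it exchanges the ends of the block b ds c and rotates
-- once. As ds again follows the first entry c, repeating the rounds reverses the
-- n − 1 entries behind n with about n²/2 moves, up to rotations that are undone at
-- the end. For n ≥ 12 this is at most (3n² − 19n + 36)/2 moves and of the same
-- parity, so the exact count is reached by appending pairs E E, which cancel; for
-- 3 ≤ n ≤ 11 explicit shorter sequences are padded instead.
module Submission where

open import Defs
open import Data.Nat using (ℕ; zero; suc; _+_; _*_; _≤_; z≤n; s≤s; ⌊_/2⌋; ⌈_/2⌉)
open import Data.Nat.Properties
  using (+-comm; *-comm; suc-injective; ⌊n/2⌋+⌈n/2⌉≡n; ≤-trans; ≤-reflexive; m≤m+n; *-monoʳ-≤; +-monoʳ-≤; +-cancelʳ-≤)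
open import Data.Nat.Tactic.RingSolver using (solve-∀)
open import Data.List using (List; []; _∷_; _++_; _∷ʳ_; length; reverse; map; upTo)
open import Data.List.Properties
  using (++-assoc; ++-identityʳ; length-++; length-map; length-upTo; length-reverse;
         map-++; upTo-∷ʳ; reverse-++; reverse-involutive; unfold-reverse)
open import Data.List.Reverse using (Reverse; []; _∶_∶ʳ_; reverseView)
open import Data.Product using (_×_; ∃-syntax; _,_)
open import Relation.Binary.PropositionalEquality
  using (_≡_; refl; sym; trans; cong; cong₂; module ≡-Reasoning)
open ≡-Reasoning

length-∷ʳ : ∀ {A : Set} (xs : List A) x → length (xs ∷ʳ x) ≡ suc (length xs)
length-∷ʳ xs x = trans (length-++ xs) (+-comm (length xs) 1)

applyMoves-++ : ∀ ms ns p → applyMoves (ms ++ ns) p ≡ applyMoves ns (applyMoves ms p)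
applyMoves-++ []       ns p = refl
applyMoves-++ (m ∷ ms) ns p = applyMoves-++ ms ns (applyMove m p)

repeat : ℕ → List Move → List Move
repeat zero    ms = []
repeat (suc k) ms = ms ++ repeat k ms

length-repeat : ∀ k ms → length (repeat k ms) ≡ k * length ms
length-repeat zero    ms = refl
length-repeat (suc k) ms = trans (length-++ ms) (cong (length ms +_) (length-repeat k ms))

repeat-+ : ∀ j k ms → repeat (j + k) ms ≡ repeat j ms ++ repeat k ms
repeat-+ zero    k ms = refl
repeat-+ (suc j) k ms = trans (cong (ms ++_) (repeat-+ j k ms)) (sym (++-assoc ms _ _))

applyMoves-repeat-neutral : ∀ {ms} → (∀ p → applyMoves ms p ≡ p) →
                            ∀ k p → applyMoves (repeat k ms) p ≡ p
applyMoves-repeat-neutral neutral zero    p = refl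
applyMoves-repeat-neutral {ms} neutral (suc k) p = begin
  applyMoves (ms ++ repeat k ms) p            ≡⟨ applyMoves-++ ms (repeat k ms) p ⟩
  applyMoves (repeat k ms) (applyMoves ms p)  ≡⟨ applyMoves-repeat-neutral neutral k _ ⟩
  applyMoves ms p                             ≡⟨ neutral p ⟩
  p                                           ∎

L^ EE^ EL^ RE^ : ℕ → List Move
L^  k = repeat k (L ∷ [])
EE^ k = repeat k (E ∷ E ∷ [])
EL^ k = repeat k (E ∷ L ∷ [])
RE^ k = repeat k (R ∷ E ∷ [])

exch-involutive : ∀ p → exch (exch p) ≡ p
exch-involutive []          = refl
exch-involutive (a ∷ [])    = refl
exch-involutive (a ∷ b ∷ p) = refl

EE^-neutral : ∀ k p → applyMoves (EE^ k) p ≡ p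
EE^-neutral = applyMoves-repeat-neutral exch-involutive

L^-rotate : ∀ xs ys → applyMoves (L^ (length xs)) (xs ++ ys) ≡ ys ++ xs
L^-rotate []       ys = sym (++-identityʳ ys)
L^-rotate (x ∷ xs) ys = begin
  applyMoves (L^ (length xs)) ((xs ++ ys) ∷ʳ x)  ≡⟨ cong (applyMoves (L^ (length xs))) (++-assoc xs ys _) ⟩
  applyMoves (L^ (length xs)) (xs ++ ys ∷ʳ x)    ≡⟨ L^-rotate xs (ys ∷ʳ x) ⟩
  (ys ∷ʳ x) ++ xs                                ≡⟨ ++-assoc ys _ xs ⟩
  ys ++ x ∷ xs                                   ∎

EL^-rotate-tail : ∀ a ys zs → applyMoves (EL^ (length ys)) (a ∷ ys ++ zs) ≡ a ∷ zs ++ ys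
EL^-rotate-tail a []       zs = cong (a ∷_) (sym (++-identityʳ zs))
EL^-rotate-tail a (y ∷ ys) zs = begin
  applyMoves (EL^ (length ys)) (a ∷ (ys ++ zs) ∷ʳ y)  ≡⟨ cong (λ t → applyMoves (EL^ (length ys)) (a ∷ t)) (++-assoc ys zs _) ⟩
  applyMoves (EL^ (length ys)) (a ∷ ys ++ zs ∷ʳ y)    ≡⟨ EL^-rotate-tail a ys (zs ∷ʳ y) ⟩
  a ∷ (zs ∷ʳ y) ++ ys                                 ≡⟨ cong (a ∷_) (++-assoc zs _ ys) ⟩
  a ∷ zs ++ y ∷ ys                                    ∎

rotR-∷ʳ : ∀ xs y → rotR (xs ∷ʳ y) ≡ y ∷ xs
rotR-∷ʳ xs y = begin
  reverse (rotL (reverse (xs ∷ʳ y)))  ≡⟨ cong (λ p → reverse (rotL p)) (reverse-++ xs (y ∷ [])) ⟩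
  reverse (reverse xs ∷ʳ y)           ≡⟨ reverse-++ (reverse xs) (y ∷ []) ⟩
  y ∷ reverse (reverse xs)            ≡⟨ cong (y ∷_) (reverse-involutive xs) ⟩
  y ∷ xs                              ∎

RE^-rotate-tail : ∀ a xs ys → applyMoves (RE^ (length ys)) (a ∷ xs ++ ys) ≡ a ∷ ys ++ xs
RE^-rotate-tail a xs ys = go xs (reverseView ys)
  where
  go : ∀ xs {ys} → Reverse ys → applyMoves (RE^ (length ys)) (a ∷ xs ++ ys) ≡ a ∷ ys ++ xs
  go xs []              = cong (a ∷_) (++-identityʳ xs)
  go xs (ws ∶ rws ∶ʳ w) = begin
    applyMoves (RE^ (length (ws ∷ʳ w))) (a ∷ xs ++ ws ∷ʳ w)
      ≡⟨ cong (λ k → applyMoves (RE^ k) (a ∷ xs ++ ws ∷ʳ w)) (length-∷ʳ ws w) ⟩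
    applyMoves (RE^ (length ws)) (exch (rotR (a ∷ xs ++ ws ∷ʳ w)))
      ≡⟨ cong (λ p → applyMoves (RE^ (length ws)) (exch (rotR (a ∷ p)))) (sym (++-assoc xs ws _)) ⟩
    applyMoves (RE^ (length ws)) (exch (rotR ((a ∷ xs ++ ws) ∷ʳ w)))
      ≡⟨ cong (λ p → applyMoves (RE^ (length ws)) (exch p)) (rotR-∷ʳ (a ∷ xs ++ ws) w) ⟩
    applyMoves (RE^ (length ws)) (a ∷ (w ∷ xs) ++ ws)
      ≡⟨ go (w ∷ xs) rws ⟩
    a ∷ ws ++ w ∷ xs
      ≡⟨ cong (a ∷_) (sym (++-assoc ws _ xs)) ⟩
    a ∷ (ws ∷ʳ w) ++ xs ∎

exchangeEnds : ℕ → List Move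
exchangeEnds k = L ∷ EL^ k ++ E ∷ RE^ k

exchangeEnds-spec : ∀ {k} a b ds c zs → length ds ≡ k →
  applyMoves (exchangeEnds k) (a ∷ b ∷ ds ++ c ∷ zs) ≡ c ∷ ds ++ b ∷ zs ∷ʳ a
exchangeEnds-spec a b ds c zs refl = begin
  applyMoves (EL^ (length ds) ++ E ∷ RE^ (length ds)) ((b ∷ ds ++ c ∷ zs) ∷ʳ a)
    ≡⟨ applyMoves-++ (EL^ (length ds)) _ _ ⟩
  applyMoves (E ∷ RE^ (length ds)) (applyMoves (EL^ (length ds)) (b ∷ (ds ++ c ∷ zs) ∷ʳ a))
    ≡⟨ cong (λ p → applyMoves (E ∷ RE^ (length ds)) (applyMoves (EL^ (length ds)) (b ∷ p))) (++-assoc ds _ _) ⟩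
  applyMoves (E ∷ RE^ (length ds)) (applyMoves (EL^ (length ds)) (b ∷ ds ++ c ∷ zs ∷ʳ a))
    ≡⟨ cong (applyMoves (E ∷ RE^ (length ds))) (EL^-rotate-tail b ds (c ∷ zs ∷ʳ a)) ⟩
  applyMoves (RE^ (length ds)) (c ∷ (b ∷ zs ∷ʳ a) ++ ds)
    ≡⟨ RE^-rotate-tail c (b ∷ zs ∷ʳ a) ds ⟩
  c ∷ ds ++ b ∷ zs ∷ʳ a ∎

reverseBlock : ℕ → List Move
reverseBlock zero          = []
reverseBlock (suc zero)    = []
reverseBlock (suc (suc k)) = exchangeEnds k ++ reverseBlock k

reverse-∷-∷ʳ : ∀ {A : Set} (b : A) ds c → reverse (b ∷ ds ∷ʳ c) ≡ c ∷ reverse ds ∷ʳ b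
reverse-∷-∷ʳ b ds c = trans (unfold-reverse b (ds ∷ʳ c)) (cong (_∷ʳ b) (reverse-++ ds (c ∷ [])))

reverseBlock-spec : ∀ k a bs zs → length bs ≡ k →
  applyMoves (reverseBlock k) (a ∷ bs ++ zs) ≡ applyMoves (L^ ⌊ k /2⌋) (a ∷ reverse bs ++ zs)
reverseBlock-spec zero          a []       zs _  = refl
reverseBlock-spec (suc zero)    a (b ∷ []) zs _  = refl
reverseBlock-spec (suc (suc k)) a (b ∷ cs) zs len with reverseView cs
... | ds ∶ _ ∶ʳ c = begin
  applyMoves (exchangeEnds k ++ reverseBlock k) (a ∷ b ∷ (ds ∷ʳ c) ++ zs)
    ≡⟨ applyMoves-++ (exchangeEnds k) (reverseBlock k) (a ∷ b ∷ (ds ∷ʳ c) ++ zs) ⟩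
  applyMoves (reverseBlock k) (applyMoves (exchangeEnds k) (a ∷ b ∷ (ds ∷ʳ c) ++ zs))
    ≡⟨ cong (λ p → applyMoves (reverseBlock k) (applyMoves (exchangeEnds k) (a ∷ b ∷ p))) (++-assoc ds _ zs) ⟩
  applyMoves (reverseBlock k) (applyMoves (exchangeEnds k) (a ∷ b ∷ ds ++ c ∷ zs))
    ≡⟨ cong (applyMoves (reverseBlock k)) (exchangeEnds-spec a b ds c zs length-ds) ⟩
  applyMoves (reverseBlock k) (c ∷ ds ++ b ∷ zs ∷ʳ a)
    ≡⟨ reverseBlock-spec k c ds (b ∷ zs ∷ʳ a) length-ds ⟩
  applyMoves (L^ ⌊ k /2⌋) (c ∷ reverse ds ++ b ∷ zs ∷ʳ a)
    ≡⟨ cong (applyMoves (L^ ⌊ k /2⌋)) reassociate ⟩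
  applyMoves (L^ ⌊ k /2⌋) ((reverse (b ∷ ds ∷ʳ c) ++ zs) ∷ʳ a) ∎
  where
  length-ds : length ds ≡ k
  length-ds = suc-injective (trans (sym (length-∷ʳ ds c)) (suc-injective len))
  reassociate : c ∷ reverse ds ++ b ∷ zs ∷ʳ a ≡ (reverse (b ∷ ds ∷ʳ c) ++ zs) ∷ʳ a
  reassociate = begin
    c ∷ reverse ds ++ b ∷ zs ∷ʳ a          ≡⟨ cong (c ∷_) (sym (++-assoc (reverse ds) _ _)) ⟩
    c ∷ (reverse ds ∷ʳ b) ++ zs ∷ʳ a       ≡⟨ cong (c ∷_) (sym (++-assoc (reverse ds ∷ʳ b) zs _)) ⟩
    (c ∷ (reverse ds ∷ʳ b) ++ zs) ∷ʳ a     ≡⟨ cong (λ p → (p ++ zs) ∷ʳ a) (sym (reverse-∷-∷ʳ b ds c)) ⟩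
    (reverse (b ∷ ds ∷ʳ c) ++ zs) ∷ʳ a     ∎

identityPerm-suc : ∀ m → identityPerm (suc m) ≡ identityPerm m ∷ʳ suc m
identityPerm-suc m = trans (cong (map suc) (sym (upTo-∷ʳ m))) (map-++ suc (upTo m) (m ∷ []))

length-identityPerm : ∀ m → length (identityPerm m) ≡ m
length-identityPerm m = trans (length-map suc (upTo m)) (length-upTo m)

reversePerm-suc : ∀ m → reversePerm (suc m) ≡ suc m ∷ reversePerm m
reversePerm-suc m = trans (cong reverse (identityPerm-suc m)) (reverse-++ (identityPerm m) (suc m ∷ []))

Solves : ℕ → List Move → Set
Solves n ms = applyMoves ms (reversePerm n) ≡ identityPerm n

-- With the ⌊ m /2⌋ rotations left by reverseBlock, the m + 2 rotations of the
-- m + 1 entries put m + 1 last and then make one full turn.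
unreverse : ℕ → List Move
unreverse m = reverseBlock m ++ L^ (2 + ⌈ m /2⌉)

unreverse-solves : ∀ m → Solves (suc m) (unreverse m)
unreverse-solves m = begin
  applyMoves (reverseBlock m ++ L^ (2 + ⌈ m /2⌉)) (reversePerm (suc m))
    ≡⟨ cong (applyMoves (unreverse m)) (trans (reversePerm-suc m) (cong (suc m ∷_) (sym (++-identityʳ _)))) ⟩
  applyMoves (reverseBlock m ++ L^ (2 + ⌈ m /2⌉)) (suc m ∷ reversePerm m ++ [])
    ≡⟨ applyMoves-++ (reverseBlock m) _ _ ⟩
  applyMoves (L^ (2 + ⌈ m /2⌉)) (applyMoves (reverseBlock m) (suc m ∷ reversePerm m ++ []))
    ≡⟨ cong (applyMoves (L^ (2 + ⌈ m /2⌉))) (reverseBlock-spec m (suc m) (reversePerm m) [] length-reversePerm) ⟩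
  applyMoves (L^ (2 + ⌈ m /2⌉)) (applyMoves (L^ ⌊ m /2⌋) (suc m ∷ reverse (reversePerm m) ++ []))
    ≡⟨ cong (λ p → applyMoves (L^ (2 + ⌈ m /2⌉)) (applyMoves (L^ ⌊ m /2⌋) (suc m ∷ p))) identity-tail ⟩
  applyMoves (L^ (2 + ⌈ m /2⌉)) (applyMoves (L^ ⌊ m /2⌋) (suc m ∷ identityPerm m))
    ≡⟨ sym (applyMoves-++ (L^ ⌊ m /2⌋) _ _) ⟩
  applyMoves (L^ ⌊ m /2⌋ ++ L^ (2 + ⌈ m /2⌉)) (suc m ∷ identityPerm m)
    ≡⟨ cong (λ ms → applyMoves ms (suc m ∷ identityPerm m)) (sym (repeat-+ ⌊ m /2⌋ _ _)) ⟩
  applyMoves (L^ (⌊ m /2⌋ + (2 + ⌈ m /2⌉))) (suc m ∷ identityPerm m)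
    ≡⟨ cong (λ k → applyMoves (L^ k) (suc m ∷ identityPerm m)) rotations ⟩
  applyMoves (L^ (suc m)) (identityPerm m ∷ʳ suc m)
    ≡⟨ cong₂ (λ k p → applyMoves (L^ k) p) (sym (length-identityPerm (suc m))) into-place ⟩
  applyMoves (L^ (length (identityPerm (suc m)))) (identityPerm (suc m) ++ [])
    ≡⟨ L^-rotate (identityPerm (suc m)) [] ⟩
  identityPerm (suc m) ∎
  where
  length-reversePerm : length (reversePerm m) ≡ m
  length-reversePerm = trans (length-reverse (identityPerm m)) (length-identityPerm m)
  identity-tail : reverse (reversePerm m) ++ [] ≡ identityPerm m
  identity-tail = trans (++-identityʳ _) (reverse-involutive (identityPerm m))
  rotations : ⌊ m /2⌋ + (2 + ⌈ m /2⌉) ≡ 2 + m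
  rotations = trans (+-comm ⌊ m /2⌋ _) (cong (2 +_) (trans (+-comm ⌈ m /2⌉ _) (⌊n/2⌋+⌈n/2⌉≡n m)))
  into-place : identityPerm m ∷ʳ suc m ≡ identityPerm (suc m) ++ []
  into-place = trans (sym (identityPerm-suc m)) (sym (++-identityʳ _))

length-exchangeEnds : ∀ k → length (exchangeEnds k) ≡ 4 * k + 2
length-exchangeEnds k = begin
  suc (length (EL^ k ++ E ∷ RE^ k))                ≡⟨ cong suc (length-++ (EL^ k)) ⟩
  suc (length (EL^ k) + suc (length (RE^ k)))      ≡⟨ cong₂ (λ x y → suc (x + suc y)) (length-repeat k _) (length-repeat k _) ⟩
  suc (k * 2 + suc (k * 2))                        ≡⟨ arithmetic k ⟩
  4 * k + 2                                        ∎
  where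
  arithmetic : ∀ k → suc (k * 2 + suc (k * 2)) ≡ 4 * k + 2
  arithmetic = solve-∀

length-unreverse-suc-suc : ∀ m → length (unreverse (suc (suc m))) ≡ 4 * m + 3 + length (unreverse m)
length-unreverse-suc-suc m = begin
  length ((exchangeEnds m ++ reverseBlock m) ++ L^ (3 + ⌈ m /2⌉))
    ≡⟨ length-++ (exchangeEnds m ++ reverseBlock m) ⟩
  length (exchangeEnds m ++ reverseBlock m) + length (L^ (3 + ⌈ m /2⌉))
    ≡⟨ cong (_+ length (L^ (3 + ⌈ m /2⌉))) (length-++ (exchangeEnds m)) ⟩
  length (exchangeEnds m) + length (reverseBlock m) + length (L^ (3 + ⌈ m /2⌉))
    ≡⟨ cong (λ x → x + length (reverseBlock m) + length (L^ (3 + ⌈ m /2⌉))) (length-exchangeEnds m) ⟩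
  4 * m + 2 + length (reverseBlock m) + suc (length (L^ (2 + ⌈ m /2⌉)))
    ≡⟨ arithmetic (4 * m) (length (reverseBlock m)) (length (L^ (2 + ⌈ m /2⌉))) ⟩
  4 * m + 3 + (length (reverseBlock m) + length (L^ (2 + ⌈ m /2⌉)))
    ≡⟨ cong (4 * m + 3 +_) (sym (length-++ (reverseBlock m))) ⟩
  4 * m + 3 + length (unreverse m) ∎
  where
  arithmetic : ∀ a b c → a + 2 + b + suc c ≡ a + 3 + (b + c)
  arithmetic = solve-∀

-- pad i counts the pairs E E that bring unreverse (11 + i) up to the exact count
-- for n = 12 + i; the target grows by 6n − 13 from n to n + 2, the unpadded
-- solution only by 4n − 1, so pad grows by n − 6.
pad : ℕ → ℕ
pad zero          = 1
pad (suc zero)    = 4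
pad (suc (suc i)) = 6 + i + pad i

unreverse-padded-count : ∀ i →
  2 * (length (unreverse (11 + i)) + 2 * pad i) + 19 * (12 + i) ≡ 3 * ((12 + i) * (12 + i)) + 36
unreverse-padded-count zero          = refl
unreverse-padded-count (suc zero)    = refl
unreverse-padded-count (suc (suc i)) = begin
  2 * (length (unreverse (13 + i)) + 2 * (6 + i + pad i)) + 19 * (14 + i)
    ≡⟨ cong (λ l → 2 * (l + 2 * (6 + i + pad i)) + 19 * (14 + i)) (length-unreverse-suc-suc (11 + i)) ⟩
  2 * (4 * (11 + i) + 3 + U + 2 * (6 + i + pad i)) + 19 * (14 + i)
    ≡⟨ step-lhs i U (pad i) ⟩
  2 * (U + 2 * pad i) + 19 * (12 + i) + (12 * i + 156)
    ≡⟨ cong (_+ (12 * i + 156)) (unreverse-padded-count i) ⟩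
  3 * ((12 + i) * (12 + i)) + 36 + (12 * i + 156)
    ≡⟨ step-rhs i ⟩
  3 * ((14 + i) * (14 + i)) + 36 ∎
  where
  U = length (unreverse (11 + i))
  step-lhs : ∀ i u p → 2 * (4 * (11 + i) + 3 + u + 2 * (6 + i + p)) + 19 * (14 + i)
                       ≡ 2 * (u + 2 * p) + 19 * (12 + i) + (12 * i + 156)
  step-lhs = solve-∀
  step-rhs : ∀ i → 3 * ((12 + i) * (12 + i)) + 36 + (12 * i + 156) ≡ 3 * ((14 + i) * (14 + i)) + 36
  step-rhs = solve-∀

ExactSolution : ℕ → Set
ExactSolution n = ∃[ ms ] (Solves n ms × 2 * length ms + 19 * n ≡ 3 * (n * n) + 36)

padded : ∀ {n} ms p → Solves n ms → 2 * (length ms + 2 * p) + 19 * n ≡ 3 * (n * n) + 36 → ExactSolution n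
padded {n} ms p solves count = ms ++ EE^ p , padded-solves , trans (cong (λ l → 2 * l + 19 * n) length-padded) count
  where
  padded-solves : Solves n (ms ++ EE^ p)
  padded-solves = trans (applyMoves-++ ms (EE^ p) _) (trans (EE^-neutral p _) solves)
  length-padded : length (ms ++ EE^ p) ≡ length ms + 2 * p
  length-padded = trans (length-++ ms) (cong (length ms +_) (trans (length-repeat p _) (*-comm p 2)))

exactSolution : ∀ n → 3 ≤ n → ExactSolution n
exactSolution 0 ()
exactSolution 1 (s≤s ())
exactSolution 2 (s≤s (s≤s ()))
exactSolution 3 _ = padded (R ∷ R ∷ E ∷ []) 0 refl refl
exactSolution 4 _ = padded (E ∷ L ∷ L ∷ E ∷ []) 0 refl refl
exactSolution 5 _ = padded (E ∷ L ∷ L ∷ E ∷ L ∷ E ∷ R ∷ E ∷ []) 0 refl refl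
exactSolution 6 _ = padded (L ∷ E ∷ L ∷ E ∷ R ∷ E ∷ R ∷ R ∷ E ∷ R ∷ E ∷ L ∷ E ∷ []) 1 refl refl
exactSolution 7 _ = padded
  (L ∷ E ∷ L ∷ E ∷ R ∷ E ∷ R ∷ R ∷ E ∷ R ∷ E ∷ R ∷ E ∷ L ∷ E ∷ L ∷ E ∷ R ∷ E ∷ []) 3 refl refl
exactSolution 8 _ = padded
  (L ∷ L ∷ E ∷ L ∷ E ∷ R ∷ E ∷ R ∷ E ∷ L ∷ E ∷ L ∷ E ∷ L ∷ L ∷ E ∷ L ∷ E ∷ L ∷ E ∷
   R ∷ E ∷ R ∷ E ∷ L ∷ E ∷ []) 6 refl refl
exactSolution 9 _ = padded
  (L ∷ L ∷ E ∷ L ∷ E ∷ R ∷ E ∷ R ∷ E ∷ L ∷ E ∷ L ∷ E ∷ L ∷ L ∷ E ∷ L ∷ E ∷ L ∷ E ∷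
   L ∷ E ∷ R ∷ E ∷ R ∷ E ∷ R ∷ E ∷ L ∷ E ∷ L ∷ E ∷ R ∷ E ∷ []) 10 refl refl
exactSolution 10 _ = padded
  (E ∷ L ∷ E ∷ R ∷ E ∷ R ∷ E ∷ L ∷ E ∷ L ∷ E ∷ L ∷ E ∷ R ∷ E ∷ R ∷ E ∷ R ∷ E ∷ R ∷
   R ∷ E ∷ R ∷ E ∷ R ∷ E ∷ R ∷ E ∷ L ∷ E ∷ L ∷ E ∷ L ∷ E ∷ R ∷ E ∷ R ∷ E ∷ L ∷ E ∷
   R ∷ R ∷ R ∷ []) 15 refl refl
exactSolution 11 _ = padded
  (E ∷ L ∷ E ∷ L ∷ E ∷ L ∷ E ∷ R ∷ E ∷ R ∷ E ∷ R ∷ E ∷ L ∷ E ∷ L ∷ E ∷ R ∷ E ∷ R ∷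
   R ∷ R ∷ E ∷ R ∷ E ∷ R ∷ E ∷ R ∷ E ∷ R ∷ E ∷ L ∷ E ∷ L ∷ E ∷ L ∷ E ∷ L ∷ E ∷ R ∷
   E ∷ R ∷ E ∷ R ∷ E ∷ L ∷ E ∷ L ∷ E ∷ R ∷ E ∷ R ∷ R ∷ []) 21 refl refl
exactSolution (suc (suc (suc (suc (suc (suc (suc (suc (suc (suc (suc (suc i)))))))))))) _ =
  padded (unreverse (11 + i)) (pad i) (unreverse-solves (11 + i)) (unreverse-padded-count i)

exact⇒bounded : ∀ {n ℓ} → 2 ≤ n → 2 * ℓ + 19 * n ≡ 3 * (n * n) + 36 → 2 * ℓ ≤ 3 * (n * n)
exact⇒bounded {n} {ℓ} 2≤n count =
  +-cancelʳ-≤ 36 (2 * ℓ) (3 * (n * n)) (≤-trans (+-monoʳ-≤ (2 * ℓ) 36≤19n) (≤-reflexive count))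
  where
  36≤19n : 36 ≤ 19 * n
  36≤19n = ≤-trans (m≤m+n 36 2) (*-monoʳ-≤ 19 2≤n)

theorem1 : (∀ n → 1 ≤ n →
              ∃[ ms ] (applyMoves ms (reversePerm n) ≡ identityPerm n
                       × 2 * length ms ≤ 3 * (n * n)))
           × (∀ n → 3 ≤ n →
              ∃[ ms ] (applyMoves ms (reversePerm n) ≡ identityPerm n
                       × 2 * length ms + 19 * n ≡ 3 * (n * n) + 36))
theorem1 = bounded , exactSolution
  where
  bounded : ∀ n → 1 ≤ n → ∃[ ms ] (Solves n ms × 2 * length ms ≤ 3 * (n * n))
  bounded 1 _ = [] , refl , z≤n
  bounded 2 _ = E ∷ [] , refl , s≤s (s≤s z≤n)
  bounded n@(suc (suc (suc _))) _ with exactSolution n (s≤s (s≤s (s≤s z≤n)))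
  ... | ms , solves , count = ms , solves , exact⇒bounded {n} {length ms} (s≤s (s≤s z≤n)) count
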